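{- For all positive integers $n,h$, $k(n,h)\le \left\lceil \frac{h-1}{h}\,n\right\rceil$. In other words, every instance with $n$ full bins of capacity $h$ and $\left\lceil \frac{h-1}{h}n\right\rceil$ empty bins is a yes-instance of $\mathrm{WSP}$.
   Context: Setting: $B$ is a finite set of bins, each of capacity $h$, and $C$ a finite set of colors. A configuration is a map $S$ assigning to each bin $b$ a sequence $S(b)$ of colors of length at most $h$, listed from bottom to top; the last element is the top unit. An instance is a configuration in which $n$ bins are full (length $h$) and $k$ bins are empty, and each color occurs exactly $hj$ times for some positive integer $j$. A configuration is sorted if every bin is either empty or contains $h$ units all of the same color. Water-move: choose distinct bins $b_1,b_2$, a color $c$ and $m\ge1$ such that $S(b_1)$ ends with $c^m$, $S(b_2)$ is empty or has top color $c$, and $|S(b_2)|+m\le h$; remove those $m$ units from the top of $b_1$ and put them on top of $b_2$, where after the move either the new top of $b_1$ is not $c$ (or $b_1$ is empty) or $b_2$ is full. $\mathrm{WSP}$: given an instance, decide whether it can be transformed into a sorted configuration by a finite sequence of water-moves. $k(n,h)$ denotes the minimum number $k$ such that all instances of $\mathrm{WSP}$ with $n$ full bins of capacity $h$ and $k$ empty bins are yes-instances. -}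

module Defs where

open import Data.Nat using (ℕ; zero; suc; _+_; _*_; _∸_; _≤_; _/_; NonZero)
open import Data.Fin using (Fin; _≟_)
open import Data.List using (List; []; _∷_; _++_; [_]; length; replicate; filter; map)
open import Data.Nat.ListAction using (sum)
open import Data.List.Base using (allFin)
open import Data.Product using (Σ; ∃; ∃-syntax; _×_; _,_)
open import Data.Sum using (_⊎_)
open import Relation.Nullary using (¬_)
open import Relation.Unary using (Decidable)
open import Relation.Binary.PropositionalEquality using (_≡_; _≢_)
open import Relation.Binary.Construct.Closure.ReflexiveTransitive using (Star)

-- Bins are Fin N, colours are Fin m.
-- A configuration lists each bin's contents from BOTTOM to TOP
-- (the last element of the list is the top unit).
Config : ℕ → ℕ → Set
Config N m = Fin N → List (Fin m)

countBins : ∀ {N} {P : Fin N → Set} → Decidable P → ℕ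
countBins {N} P? = length (filter P? (allFin N))

occurrences : ∀ {N m} → Config N m → Fin m → ℕ
occurrences {N} S c = sum (map (λ b → length (filter (c ≟_) (S b))) (allFin N))

⌈_/_⌉ : ℕ → (b : ℕ) → .{{NonZero b}} → ℕ
⌈ a / b ⌉ = (a + (b ∸ 1)) / b

IsInstance : (h n k m : ℕ) → Config (n + k) m → Set
IsInstance h n k m S =
    countBins (λ b → length (S b) Data.Nat.≟ h) ≡ n
  × countBins (λ b → length (S b) Data.Nat.≟ 0) ≡ k
  × ((c : Fin m) → ∃[ j ] (1 ≤ j × occurrences S c ≡ h * j))

Sorted : ∀ {N m} → ℕ → Config N m → Set
Sorted {N} {m} h S = (b : Fin N) → S b ≡ [] ⊎ ∃[ c ] (S b ≡ replicate h c)

TopIs : ∀ {m} → List (Fin m) → Fin m → Set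
TopIs xs c = ∃[ zs ] (xs ≡ zs ++ [ c ])

WaterMove : ∀ {N m} → ℕ → Config N m → Config N m → Set
WaterMove {N} {m} h S S' =
  Σ (Fin N) λ b₁ → Σ (Fin N) λ b₂ → Σ (Fin m) λ c → Σ ℕ λ k → Σ (List (Fin m)) λ xs →
      b₁ ≢ b₂
    × 1 ≤ k
    × S b₁ ≡ xs ++ replicate k c
    × (S b₂ ≡ [] ⊎ TopIs (S b₂) c)
    × length (S b₂) + k ≤ h
    × S' b₁ ≡ xs
    × S' b₂ ≡ S b₂ ++ replicate k c
    × ((b : Fin N) → b ≢ b₁ → b ≢ b₂ → S' b ≡ S b)
    × (¬ TopIs xs c ⊎ length (S' b₂) ≡ h)

Solvable : ∀ {N m} → ℕ → Config N m → Set
Solvable {N} {m} h S = ∃[ S' ] (Star (WaterMove h) S S' × Sorted h S')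

{-# OPTIONS --safe #-}
-- Weigh a configuration by 3 · (number of adjacent unequal units, summed over the bins) plus
-- the number of partial bins (neither empty nor full). A move touches two bins, so it changes
-- at most two partial flags, and destroying a break always pays. While the configuration is
-- unsorted, some water-move lowers the weight. Two partial bins with the same top colour can
-- be merged. Otherwise, a bin with a break can shed its top block into an empty bin, if there
-- is one. If there is none, count units twice. Per bin, every bin being nonempty gives
-- k·h ≤ (h − 1)·P for the number P of partial bins; per colour, the partial bins have distinct
-- top colours, each with at least h units, so P ≤ n. Against (h − 1)·n ≤ k·h, which is what
-- ⌈(h − 1)n/h⌉ empty bins provide, both bounds are tight: every partial bin holds one unit
-- and every colour tops a partial bin, so the broken bin's top block fits onto that unit.
-- Without breaks or mergeable pairs, a partial monochrome bin would leave its colour with a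
-- number of units not divisible by h, so the configuration is sorted.
module Submission where

open import Defs
open import Data.Nat
  using (ℕ; zero; suc; _+_; _*_; _∸_; _≤_; _<_; z≤n; s≤s; _≤?_; _<?_; NonZero; _/_; _%_; >-nonZero; >-nonZero⁻¹)
import Data.Nat as ℕ
open import Data.Nat.Properties hiding (_≟_)
open import Data.Nat.DivMod using (m≡m%n+[m/n]*n; m%n<n)
open import Data.Nat.Divisibility using (_∣_; divides; _∣0; ∣-refl; ∣m∣n⇒∣m+n; ∣m+n∣m⇒∣n; ∣⇒≤)
import Data.Nat.ListAction as List
open import Data.Nat.Tactic.RingSolver using (solve-∀)
open import Algebra.Properties.Semiring.Sum +-*-semiring
  using (sum; sum-syntax; sum-cong-≗; ∑-distrib-+; ∑-comm; *-distribʳ-sum)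
open import Data.Fin using (Fin; zero; suc; _≟_)
open import Data.Fin.Properties as Fin using (any?)
open import Data.Vec.Functional using (updateAt)
open import Data.Vec.Functional.Properties using (updateAt-updates; updateAt-minimal)
open import Data.List
  using (List; []; _∷_; _++_; [_]; _∷ʳ_; length; replicate; filter; last; map; tabulate; initLast; _∷ʳ′_)
open import Data.List.Properties
  using (++-assoc; ++-identityʳ; length-++; length-replicate; length-++-≤ˡ; filter-++; ∷-injectiveʳ)
open import Data.Maybe using (just)
import Data.Maybe.Properties as Maybe
open import Data.Product using (Σ; ∃; ∃₂; _×_; _,_; proj₁; proj₂)
open import Data.Sum using (_⊎_; inj₁; inj₂)
open import Data.Empty using (⊥-elim)
open import Function using (_∘_; const)
open import Level using (Level)
open import Relation.Nullary using (¬_; Dec; yes; no; ¬?)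
open import Relation.Nullary.Decidable using (_×-dec_)
open import Relation.Unary using (Pred; Decidable)
open import Relation.Binary.PropositionalEquality hiding ([_])
open import Relation.Binary.Construct.Closure.ReflexiveTransitive using (ε; _◅_)

private variable
  ℓ : Level
  A P : Set ℓ
  m N : ℕ
  x y c : Fin m
  xs ys : List (Fin m)

-- Indicators and finite sums

𝟙 : Dec P → ℕ
𝟙 (yes _) = 1
𝟙 (no _)  = 0

𝟙≤1 : (P? : Dec P) → 𝟙 P? ≤ 1
𝟙≤1 (yes _) = s≤s z≤n
𝟙≤1 (no _)  = z≤n

𝟙-yes : (P? : Dec P) → P → 𝟙 P? ≡ 1
𝟙-yes (yes _) _ = refl
𝟙-yes (no ¬p) p = ⊥-elim (¬p p)

𝟙-no : (P? : Dec P) → ¬ P → 𝟙 P? ≡ 0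
𝟙-no (yes p) ¬p = ⊥-elim (¬p p)
𝟙-no (no _)  _  = refl

𝟙-witness : (P? : Dec P) → 1 ≤ 𝟙 P? → P
𝟙-witness (yes p) _ = p

sum-zero : (f : Fin N → ℕ) → (∀ i → f i ≡ 0) → sum f ≡ 0
sum-zero {zero}  f f≡0 = refl
sum-zero {suc N} f f≡0 = cong₂ _+_ (f≡0 zero) (sum-zero (f ∘ suc) (f≡0 ∘ suc))

sum-const : ∀ N x → ∑[ i < N ] x ≡ N * x
sum-const zero    x = refl
sum-const (suc N) x = cong (x +_) (sum-const N x)

sum-mono-≤ : {f g : Fin N → ℕ} → (∀ i → f i ≤ g i) → sum f ≤ sum g
sum-mono-≤ {zero}  f≤g = z≤n
sum-mono-≤ {suc N} f≤g = +-mono-≤ (f≤g zero) (sum-mono-≤ (f≤g ∘ suc))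

sum-mono-< : {f g : Fin N → ℕ} → (∀ i → f i ≤ g i) → ∀ b → f b < g b → sum f < sum g
sum-mono-< f≤g zero    fb<gb = +-mono-<-≤ fb<gb (sum-mono-≤ (f≤g ∘ suc))
sum-mono-< f≤g (suc b) fb<gb = +-mono-≤-< (f≤g zero) (sum-mono-< (f≤g ∘ suc) b fb<gb)

≤-sum : (f : Fin N → ℕ) → ∀ b → f b ≤ sum f
≤-sum f zero    = m≤m+n _ _
≤-sum f (suc b) = ≤-trans (≤-sum (f ∘ suc) b) (m≤n+m _ _)

sum-positive : (f : Fin N → ℕ) → 1 ≤ sum f → ∃ λ b → 1 ≤ f b
sum-positive {suc N} f 1≤Σ with f zero in f₀
... | suc _ = zero , subst (1 ≤_) (sym f₀) (s≤s z≤n)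
... | zero with sum-positive (f ∘ suc) 1≤Σ
...   | b , 1≤fb = suc b , 1≤fb

∣-sum : ∀ {d} (f : Fin N → ℕ) → (∀ i → d ∣ f i) → d ∣ sum f
∣-sum {zero}  {d} f d∣f = d ∣0
∣-sum {suc N}     f d∣f = ∣m∣n⇒∣m+n (d∣f zero) (∣-sum (f ∘ suc) (d∣f ∘ suc))

sum-updateAt : (φ : A → ℕ) (t : Fin N → A) (b : Fin N) (x : A) →
               sum (φ ∘ updateAt t b (const x)) + φ (t b) ≡ sum (φ ∘ t) + φ x
sum-updateAt φ t zero x = rearrange (φ x) (sum (φ ∘ t ∘ suc)) (φ (t zero))
  where
  rearrange : ∀ a s c → a + s + c ≡ c + s + a
  rearrange = solve-∀
sum-updateAt φ t (suc b) x = begin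
  φ (t zero) + sum (φ ∘ updateAt (t ∘ suc) b (const x)) + φ (t (suc b))
    ≡⟨ +-assoc (φ (t zero)) _ _ ⟩
  φ (t zero) + (sum (φ ∘ updateAt (t ∘ suc) b (const x)) + φ (t (suc b)))
    ≡⟨ cong (φ (t zero) +_) (sum-updateAt φ (t ∘ suc) b x) ⟩
  φ (t zero) + (sum (φ ∘ t ∘ suc) + φ x)
    ≡⟨ +-assoc (φ (t zero)) _ _ ⟨
  sum (φ ∘ t) + φ x ∎
  where open ≡-Reasoning

sum-𝟙-≟ : (x : Fin N) → ∑[ i < N ] 𝟙 (i ≟ x) ≡ 1
sum-𝟙-≟ {suc N} zero = cong suc (sum-zero {N} _ (λ _ → refl))
sum-𝟙-≟ {suc N} (suc x) = trans (sum-cong-≗ shift) (sum-𝟙-≟ x)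
  where
  shift : ∀ i → 𝟙 (suc i ≟ suc x) ≡ 𝟙 (i ≟ x)
  shift i with i ≟ x
  ... | yes _ = refl
  ... | no _  = refl

sum-≤1 : (f : Fin N → ℕ) → (∀ i → f i ≤ 1) → (∀ i j → 1 ≤ f i → 1 ≤ f j → i ≡ j) →
         sum f ≤ 1
sum-≤1 {zero}  f f≤1 unique = z≤n
sum-≤1 {suc N} f f≤1 unique with 1 ≤? f zero
... | no f₀≱1 = subst (_≤ 1) (cong (_+ sum (f ∘ suc)) (sym (n<1⇒n≡0 (≰⇒> f₀≱1))))
                 (sum-≤1 (f ∘ suc) (f≤1 ∘ suc) (λ i j 1≤fi 1≤fj →
                   Fin.suc-injective (unique (suc i) (suc j) 1≤fi 1≤fj)))
... | yes 1≤f₀ = begin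
  f zero + sum (f ∘ suc) ≡⟨ cong (f zero +_) (sum-zero (f ∘ suc) rest≡0) ⟩
  f zero + 0             ≡⟨ +-identityʳ _ ⟩
  f zero                 ≤⟨ f≤1 zero ⟩
  1                      ∎
  where
  open ≤-Reasoning
  rest≡0 : ∀ i → f (suc i) ≡ 0
  rest≡0 i = n<1⇒n≡0 (≰⇒> (λ 1≤fi → Fin.0≢1+n (unique zero (suc i) 1≤f₀ 1≤fi)))

sum-≡-pointwise : {f g : Fin N → ℕ} → (∀ i → f i ≤ g i) → sum f ≡ sum g → ∀ i → f i ≡ g i
sum-≡-pointwise f≤g Σf≡Σg i =
  ≤-antisym (f≤g i) (≮⇒≥ (λ fi<gi → <-irrefl Σf≡Σg (sum-mono-< f≤g i fi<gi)))

length-filter-tabulate : ∀ {p} {P : Pred A p} (P? : Decidable P) (f : Fin N → A) →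
                         length (filter P? (tabulate f)) ≡ ∑[ i < N ] 𝟙 (P? (f i))
length-filter-tabulate {N = zero}  P? f = refl
length-filter-tabulate {N = suc N} P? f with P? (f zero)
... | yes _ = cong suc (length-filter-tabulate P? (f ∘ suc))
... | no _  = length-filter-tabulate P? (f ∘ suc)

sum-map-tabulate : (g : A → ℕ) (f : Fin N → A) →
                   List.sum (map g (tabulate f)) ≡ sum (g ∘ f)
sum-map-tabulate {N = zero}  g f = refl
sum-map-tabulate {N = suc N} g f = cong (g (f zero) +_) (sum-map-tabulate g (f ∘ suc))

countBins≡∑ : {P : Fin N → Set} (P? : Decidable P) → countBins P? ≡ ∑[ b < N ] 𝟙 (P? b)
countBins≡∑ P? = length-filter-tabulate P? (λ b → b)

occurrences≡∑ : (S : Config N m) (c : Fin m) → occurrences S c ≡ ∑[ b < N ] length (filter (c ≟_) (S b))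
occurrences≡∑ S c = sum-map-tabulate (λ b → length (filter (c ≟_) (S b))) (λ b → b)

-- Arithmetic of the double count

private
  regroup-capacity : ∀ n k P h → (n + k) * h + P ≡ n * h + (k * h + P)
  regroup-capacity = solve-∀

  unfold-capacity : ∀ n P h′ → n * suc h′ + P * suc h′ ≡ n * suc h′ + (P * h′ + P)
  unfold-capacity n P h′ = cong (n * suc h′ +_) (trans (*-suc P h′) (+-comm P _))

capacity-surplus-≤ : ∀ n k P h′ → (n + k) * suc h′ + P ≤ n * suc h′ + P * suc h′ →
                     k * suc h′ ≤ P * h′
capacity-surplus-≤ n k P h′ le =
  +-cancelʳ-≤ P _ _ (+-cancelˡ-≤ (n * suc h′) _ _
    (subst₂ _≤_ (regroup-capacity n k P (suc h′)) (unfold-capacity n P h′) le))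

capacity-surplus-< : ∀ n k P h′ → (n + k) * suc h′ + P < n * suc h′ + P * suc h′ →
                     k * suc h′ < P * h′
capacity-surplus-< n k P h′ lt =
  +-cancelʳ-< P _ _ (+-cancelˡ-< (n * suc h′) _ _
    (subst₂ _<_ (regroup-capacity n k P (suc h′)) (unfold-capacity n P h′) lt))

spare-vs-capacity-< : ∀ h {n k P} → (h ∸ 1) * n ≤ k * h → P * h ≤ n * h →
                      ¬ ((n + k) * h + P < n * h + P * h)
spare-vs-capacity-< zero {n} {k} {P} _ _ lt
  rewrite *-zeroʳ (n + k) | *-zeroʳ n | *-zeroʳ P = n≮0 lt
spare-vs-capacity-< (suc h′) {n} {k} {P} spare P*h≤n*h lt = <-irrefl refl (begin-strict
  k * suc h′ <⟨ capacity-surplus-< n k P h′ lt ⟩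
  P * h′     ≤⟨ *-monoˡ-≤ h′ (*-cancelʳ-≤ P n (suc h′) P*h≤n*h) ⟩
  n * h′     ≡⟨ *-comm n h′ ⟩
  h′ * n     ≤⟨ spare ⟩
  k * suc h′ ∎)
  where open ≤-Reasoning

spare-vs-capacity-≤ : ∀ h {n k P} → 2 ≤ h → (h ∸ 1) * n ≤ k * h → suc P * h ≤ n * h →
                      ¬ ((n + k) * h + P ≤ n * h + P * h)
spare-vs-capacity-≤ (suc zero) (s≤s ())
spare-vs-capacity-≤ (suc h′@(suc _)) {n} {k} {P} _ spare P<n le = <-irrefl refl (begin-strict
  k * suc h′ ≤⟨ capacity-surplus-≤ n k P h′ le ⟩
  P * h′     <⟨ *-monoˡ-< h′ (*-cancelʳ-≤ (suc P) n (suc h′) P<n) ⟩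
  n * h′     ≡⟨ *-comm n h′ ⟩
  h′ * n     ≤⟨ spare ⟩
  k * suc h′ ∎)
  where open ≤-Reasoning

m≤⌈m/n⌉*n : ∀ m n .{{_ : NonZero n}} → m ≤ ⌈ m / n ⌉ * n
m≤⌈m/n⌉*n m (suc n) = +-cancelʳ-≤ n m _ (begin
  m + n                         ≡⟨ m≡m%n+[m/n]*n (m + n) (suc n) ⟩
  (m + n) % suc n + q * suc n   ≤⟨ +-monoˡ-≤ (q * suc n) (≤-pred (m%n<n (m + n) (suc n))) ⟩
  n + q * suc n                 ≡⟨ +-comm n _ ⟩
  q * suc n + n                 ∎)
  where
  open ≤-Reasoning
  q = (m + n) / suc n

-- Bins as stacks: colour counts, breaks and top blocks

replicate-+ : ∀ i j (x : A) → replicate (i + j) x ≡ replicate i x ++ replicate j x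
replicate-+ zero    j x = refl
replicate-+ (suc i) j x = cong (x ∷_) (replicate-+ i j x)

length≡0⇒[] : {zs : List A} → length zs ≡ 0 → zs ≡ []
length≡0⇒[] {zs = []} _ = refl

count : Fin m → List (Fin m) → ℕ
count c xs = length (filter (c ≟_) xs)

count-++ : ∀ (c : Fin m) xs ys → count c (xs ++ ys) ≡ count c xs + count c ys
count-++ c xs ys = trans (cong length (filter-++ (c ≟_) xs ys)) (length-++ (filter (c ≟_) xs))

count-∷ : ∀ (c : Fin m) x xs → count c (x ∷ xs) ≡ 𝟙 (c ≟ x) + count c xs
count-∷ c x xs with c ≟ x
... | yes _ = refl
... | no _  = refl

count-replicate-≡ : ∀ (c : Fin m) k → count c (replicate k c) ≡ k
count-replicate-≡ c zero    = refl
count-replicate-≡ c (suc k) rewrite count-∷ c c (replicate k c) | 𝟙-yes (c ≟ c) refl =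
  cong suc (count-replicate-≡ c k)

count-replicate-≢ : ∀ {c d : Fin m} k → c ≢ d → count c (replicate k d) ≡ 0
count-replicate-≢ zero    c≢d = refl
count-replicate-≢ {c = c} {d = d} (suc k) c≢d rewrite count-∷ c d (replicate k d) | 𝟙-no (c ≟ d) c≢d =
  count-replicate-≢ k c≢d

TopIs⇒count : TopIs xs c → 1 ≤ count c xs
TopIs⇒count {c = c} (zs , refl) =
  subst (1 ≤_) (sym (trans (count-++ c zs [ c ]) (cong (count c zs +_) (count-replicate-≡ c 1))))
               (m≤n+m 1 (count c zs))

breaks : List (Fin m) → ℕ
breaks []           = 0
breaks (_ ∷ [])     = 0
breaks (x ∷ y ∷ ys) = 𝟙 (¬? (x ≟ y)) + breaks (y ∷ ys)

breaks-++-∷ : ∀ (xs : List (Fin m)) y ys → breaks (xs ++ y ∷ ys) ≡ breaks (xs ∷ʳ y) + breaks (y ∷ ys)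
breaks-++-∷ []           y ys = refl
breaks-++-∷ (x ∷ [])     y ys = cong (_+ breaks (y ∷ ys)) (sym (+-identityʳ _))
breaks-++-∷ (x ∷ x′ ∷ xs) y ys =
  trans (cong (𝟙 (¬? (x ≟ x′)) +_) (breaks-++-∷ (x′ ∷ xs) y ys)) (sym (+-assoc (𝟙 (¬? (x ≟ x′))) _ _))

breaks-replicate : ∀ k (c : Fin m) → breaks (replicate k c) ≡ 0
breaks-replicate zero          c = refl
breaks-replicate (suc zero)    c = refl
breaks-replicate (suc (suc k)) c =
  trans (cong (_+ breaks (c ∷ replicate k c)) (𝟙-no (¬? (c ≟ c)) (λ c≢c → c≢c refl)))
        (breaks-replicate (suc k) c)

breaks-++-replicate : ∀ (xs : List (Fin m)) k c → breaks (xs ++ replicate (suc k) c) ≡ breaks (xs ∷ʳ c)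
breaks-++-replicate xs k c =
  trans (breaks-++-∷ xs c (replicate k c))
        (trans (cong (breaks (xs ∷ʳ c) +_) (breaks-replicate (suc k) c)) (+-identityʳ _))

breaks-stack : ∀ (ys : List (Fin m)) k c → ys ≡ [] ⊎ TopIs ys c → breaks (ys ++ replicate k c) ≡ breaks ys
breaks-stack ys       zero    c _ = cong breaks (++-identityʳ ys)
breaks-stack .[]      (suc k) c (inj₁ refl) = breaks-replicate (suc k) c
breaks-stack .(zs ∷ʳ c) (suc k) c (inj₂ (zs , refl)) =
  trans (cong breaks (++-assoc zs [ c ] (replicate (suc k) c))) (breaks-++-replicate zs (suc k) c)

¬TopIs-[] : ¬ TopIs [] c
¬TopIs-[] ([] , ())
¬TopIs-[] (_ ∷ _ , ())

TopIs-[_] : ∀ x → TopIs [ x ] c → x ≡ c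
TopIs-[ x ] ([] , refl) = refl
TopIs-[ x ] (_ ∷ [] , ())
TopIs-[ x ] (_ ∷ _ ∷ _ , ())

TopIs-∷ : TopIs (x ∷ y ∷ ys) c → TopIs (y ∷ ys) c
TopIs-∷ ([] , ())
TopIs-∷ (_ ∷ zs , eq) = zs , ∷-injectiveʳ eq

TopIs-++-replicate : ∀ (xs : List (Fin m)) k c → TopIs (xs ++ replicate (suc k) c) c
TopIs-++-replicate xs zero    c = xs , refl
TopIs-++-replicate xs (suc k) c with TopIs-++-replicate (xs ∷ʳ c) k c
... | zs , eq = zs , trans (sym (++-assoc xs [ c ] _)) eq

last-∷ʳ : ∀ xs (x : Fin m) → last (xs ∷ʳ x) ≡ just x
last-∷ʳ []           x = refl
last-∷ʳ (_ ∷ [])     x = refl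
last-∷ʳ (_ ∷ y ∷ ys) x = last-∷ʳ (y ∷ ys) x

TopIs⇒last : TopIs xs c → last xs ≡ just c
TopIs⇒last (zs , refl) = last-∷ʳ zs _

last⇒TopIs : ∀ (xs : List (Fin m)) → last xs ≡ just c → TopIs xs c
last⇒TopIs xs eq with initLast xs
last⇒TopIs .(zs ∷ʳ y) eq | zs ∷ʳ′ y
  rewrite Maybe.just-injective (trans (sym (last-∷ʳ zs y)) eq) = zs , refl

breaks-unstack : ∀ (xs : List (Fin m)) k c → ¬ TopIs xs c → xs ≢ [] →
                 breaks (xs ++ replicate (suc k) c) ≡ suc (breaks xs)
breaks-unstack xs k c ¬top xs≢[] with initLast xs
... | [] = ⊥-elim (xs≢[] refl)
... | zs ∷ʳ′ y = begin
  breaks (zs ∷ʳ y ++ replicate (suc k) c) ≡⟨ breaks-++-replicate (zs ∷ʳ y) k c ⟩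
  breaks (zs ∷ʳ y ∷ʳ c)                   ≡⟨ cong breaks (++-assoc zs [ y ] [ c ]) ⟩
  breaks (zs ++ y ∷ c ∷ [])               ≡⟨ breaks-++-∷ zs y [ c ] ⟩
  breaks (zs ∷ʳ y) + (𝟙 (¬? (y ≟ c)) + 0)
    ≡⟨ cong (λ b → breaks (zs ∷ʳ y) + (b + 0)) (𝟙-yes (¬? (y ≟ c)) y≢c) ⟩
  breaks (zs ∷ʳ y) + 1                    ≡⟨ +-comm _ 1 ⟩
  suc (breaks (zs ∷ʳ y))                  ∎
  where
  open ≡-Reasoning
  y≢c : y ≢ c
  y≢c refl = ¬top (zs , refl)

record TopBlock {m : ℕ} (l : List (Fin m)) : Set where
  constructor block
  field
    below     : List (Fin m)
    colour    : Fin m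
    height    : ℕ
    split     : l ≡ below ++ replicate (suc height) colour
    below-top : ¬ TopIs below colour

topBlock : ∀ (x : Fin m) xs → TopBlock (x ∷ xs)
topBlock x [] = block [] x 0 refl ¬TopIs-[]
topBlock x (y ∷ ys) with topBlock y ys
... | block (b ∷ bs) c k split ¬top = block (x ∷ b ∷ bs) c k (cong (x ∷_) split) (¬top ∘ TopIs-∷)
... | block [] c k split _ with x ≟ c
...   | yes refl = block [] x (suc k) (cong (x ∷_) split) ¬TopIs-[]
...   | no x≢c   = block [ x ] c k (cong (x ∷_) split) (x≢c ∘ TopIs-[ x ])

topBlockOf : ∀ (l : List (Fin m)) → 1 ≤ length l → TopBlock l
topBlockOf (x ∷ xs) _ = topBlock x xs

module _ {m : ℕ} {l : List (Fin m)} (t : TopBlock l) where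
  open TopBlock t

  length-block : length l ≡ length below + suc height
  length-block = trans (cong length split)
                       (trans (length-++ below) (cong (length below +_) (length-replicate (suc height))))

  last-block : last l ≡ just colour
  last-block = trans (cong last split) (TopIs⇒last (TopIs-++-replicate below height colour))

  breaks-block : below ≢ [] → breaks l ≡ suc (breaks below)
  breaks-block below≢[] = trans (cong breaks split) (breaks-unstack below height colour below-top below≢[])

monochrome : ∀ (l : List (Fin m)) → breaks l ≡ 0 → l ≡ [] ⊎ ∃₂ λ k c → l ≡ replicate (suc k) c
monochrome []       _     = inj₁ refl
monochrome (x ∷ xs) b≡0 with topBlock x xs
... | block [] c k split _ = inj₂ (k , c , split)
... | t@(block (_ ∷ _) _ _ _ _) = ⊥-elim (1+n≢0 (trans (sym (breaks-block t λ ())) b≡0))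

∑-count : ∀ (xs : List (Fin m)) → ∑[ c < m ] count c xs ≡ length xs
∑-count {m} []   = sum-zero {m} (λ c → count c []) (λ _ → refl)
∑-count (x ∷ xs) = begin
  ∑[ c < _ ] count c (x ∷ xs)                   ≡⟨ sum-cong-≗ (λ c → count-∷ c x xs) ⟩
  ∑[ c < _ ] (𝟙 (c ≟ x) + count c xs)           ≡⟨ ∑-distrib-+ (λ c → 𝟙 (c ≟ x)) (λ c → count c xs) ⟩
  ∑[ c < _ ] 𝟙 (c ≟ x) + ∑[ c < _ ] count c xs ≡⟨ cong₂ _+_ (sum-𝟙-≟ x) (∑-count xs) ⟩
  suc (length xs)                               ∎
  where open ≡-Reasoning

brokenBlock : ∀ (l : List (Fin m)) → 1 ≤ breaks l → Σ (TopBlock l) λ t → TopBlock.below t ≢ []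
brokenBlock (x ∷ xs) broken with topBlock x xs
... | t@(block (_ ∷ _) _ _ _ _) = t , λ ()
... | block [] c k split _ =
  ⊥-elim (<-irrefl (sym (breaks-replicate (suc k) c)) (subst (1 ≤_) (cong breaks split) broken))

-- Water-moves that lower the potential

module Sorting {m : ℕ} (h : ℕ) where

  private
    Colour = Fin m

  Partial : List Colour → Set
  Partial l = 1 ≤ length l × length l < h

  partial? : ∀ l → Dec (Partial l)
  partial? l = 1 ≤? length l ×-dec length l <? h

  full-or-partial : ∀ l → 1 ≤ length l → length l ≤ h → length l ≡ h ⊎ Partial l
  full-or-partial l nonempty bounded with length l ℕ.≟ h
  ... | yes full = inj₁ full
  ... | no ¬full = inj₂ (nonempty , ≤∧≢⇒< bounded ¬full)

  weight : List Colour → ℕ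
  weight l = 3 * breaks l + 𝟙 (partial? l)

  potential : ∀ {N} → Config N m → ℕ
  potential S = sum (weight ∘ S)

  weight-pair : ∀ u v → weight u + weight v ≡ 3 * (breaks u + breaks v) + (𝟙 (partial? u) + 𝟙 (partial? v))
  weight-pair u v = regroup (breaks u) (breaks v) (𝟙 (partial? u)) (𝟙 (partial? v))
    where
    regroup : ∀ a b c d → 3 * a + c + (3 * b + d) ≡ 3 * (a + b) + (c + d)
    regroup = solve-∀

  weights-drop-by-breaks : ∀ u₁ u₂ v₁ v₂ → breaks v₁ + breaks v₂ < breaks u₁ + breaks u₂ →
                           weight v₁ + weight v₂ < weight u₁ + weight u₂
  weights-drop-by-breaks u₁ u₂ v₁ v₂ fewer rewrite weight-pair v₁ v₂ | weight-pair u₁ u₂ = begin-strict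
    3 * B′ + (𝟙 (partial? v₁) + 𝟙 (partial? v₂))
      ≤⟨ +-monoʳ-≤ (3 * B′) (+-mono-≤ (𝟙≤1 (partial? v₁)) (𝟙≤1 (partial? v₂))) ⟩
    3 * B′ + 2                                   <⟨ +-monoʳ-< (3 * B′) (n<1+n 2) ⟩
    3 * B′ + 3                                   ≡⟨ trans (+-comm (3 * B′) 3) (sym (*-suc 3 B′)) ⟩
    3 * suc B′                                   ≤⟨ *-monoʳ-≤ 3 fewer ⟩
    3 * B                                        ≤⟨ m≤m+n (3 * B) _ ⟩
    3 * B + (𝟙 (partial? u₁) + 𝟙 (partial? u₂)) ∎
    where
    open ≤-Reasoning
    B′ = breaks v₁ + breaks v₂
    B  = breaks u₁ + breaks u₂

  weights-drop-by-partials : ∀ u₁ u₂ v₁ v₂ → breaks v₁ + breaks v₂ ≡ breaks u₁ + breaks u₂ →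
                             𝟙 (partial? v₁) + 𝟙 (partial? v₂) < 𝟙 (partial? u₁) + 𝟙 (partial? u₂) →
                             weight v₁ + weight v₂ < weight u₁ + weight u₂
  weights-drop-by-partials u₁ u₂ v₁ v₂ same fewer
    rewrite weight-pair v₁ v₂ | weight-pair u₁ u₂ | same = +-monoʳ-< (3 * (breaks u₁ + breaks u₂)) fewer

  record Move {N} (S : Config N m) : Set where
    field
      source target  : Fin N
      colour         : Colour
      amount         : ℕ
      rest           : List Colour
      source≢target  : source ≢ target
      amount-pos     : 1 ≤ amount
      source-split   : S source ≡ rest ++ replicate amount colour
      target-top     : S target ≡ [] ⊎ TopIs (S target) colour
      fits           : length (S target) + amount ≤ h
      maximal        : ¬ TopIs rest colour ⊎ length (S target) + amount ≡ h

    poured : List Colour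
    poured = S target ++ replicate amount colour

    after : Config N m
    after = updateAt (updateAt S source (const rest)) target (const poured)

    after-source : after source ≡ rest
    after-source = trans (updateAt-minimal source target _ source≢target) (updateAt-updates source S)

    after-target : after target ≡ poured
    after-target = updateAt-updates target _

    after-other : ∀ b → b ≢ source → b ≢ target → after b ≡ S b
    after-other b b≢s b≢t = trans (updateAt-minimal b target _ b≢t) (updateAt-minimal b source S b≢s)

    length-poured : length poured ≡ length (S target) + amount
    length-poured = trans (length-++ (S target)) (cong (length (S target) +_) (length-replicate amount))

    waterMove : WaterMove h S after
    waterMove = source , target , colour , amount , rest , source≢target , amount-pos , source-split ,
                target-top , fits , after-source , after-target , after-other , full-or-done maximal
      where
      full-or-done : _ ⊎ length (S target) + amount ≡ h → ¬ TopIs rest colour ⊎ length (after target) ≡ h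
      full-or-done (inj₁ ¬top) = inj₁ ¬top
      full-or-done (inj₂ full) = inj₂ (trans (cong length after-target) (trans length-poured full))

    sum-after : ∀ (φ : List Colour → ℕ) →
                sum (φ ∘ after) + (φ (S source) + φ (S target)) ≡ sum (φ ∘ S) + (φ rest + φ poured)
    sum-after φ = begin
      Σ′ + (φ (S source) + φ (S target)) ≡⟨ cong (Σ′ +_) (+-comm (φ (S source)) _) ⟩
      Σ′ + (φ (S target) + φ (S source)) ≡⟨ +-assoc Σ′ _ _ ⟨
      Σ′ + φ (S target) + φ (S source)
        ≡⟨ cong (λ x → Σ′ + φ x + φ (S source)) (updateAt-minimal target source S (source≢target ∘ sym)) ⟨
      Σ′ + φ (T target) + φ (S source)   ≡⟨ cong (_+ φ (S source)) (sum-updateAt φ T target poured) ⟩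
      ΣT + φ poured + φ (S source)       ≡⟨ +-assoc ΣT _ _ ⟩
      ΣT + (φ poured + φ (S source))     ≡⟨ cong (ΣT +_) (+-comm (φ poured) _) ⟩
      ΣT + (φ (S source) + φ poured)     ≡⟨ +-assoc ΣT _ _ ⟨
      ΣT + φ (S source) + φ poured       ≡⟨ cong (_+ φ poured) (sum-updateAt φ S source rest) ⟩
      sum (φ ∘ S) + φ rest + φ poured    ≡⟨ +-assoc (sum (φ ∘ S)) _ _ ⟩
      sum (φ ∘ S) + (φ rest + φ poured)  ∎
      where
      open ≡-Reasoning
      T = updateAt S source (const rest)
      Σ′ = sum (φ ∘ after)
      ΣT = sum (φ ∘ T)

    conserved : ∀ (φ : List Colour → ℕ) → (∀ xs ys → φ (xs ++ ys) ≡ φ xs + φ ys) →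
                sum (φ ∘ after) ≡ sum (φ ∘ S)
    conserved φ additive = +-cancelʳ-≡ _ _ _ (trans (sum-after φ) (cong (sum (φ ∘ S) +_) balance))
      where
      open ≡-Reasoning
      moved = φ (replicate amount colour)
      balance : φ rest + φ poured ≡ φ (S source) + φ (S target)
      balance = begin
        φ rest + φ poured                 ≡⟨ cong (φ rest +_) (additive (S target) _) ⟩
        φ rest + (φ (S target) + moved)   ≡⟨ cong (φ rest +_) (+-comm (φ (S target)) moved) ⟩
        φ rest + (moved + φ (S target))   ≡⟨ +-assoc (φ rest) _ _ ⟨
        φ rest + moved + φ (S target)
          ≡⟨ cong (_+ φ (S target)) (trans (sym (additive rest _)) (cong φ (sym source-split))) ⟩
        φ (S source) + φ (S target)       ∎

    decreasing : ∀ (φ : List Colour → ℕ) → φ rest + φ poured < φ (S source) + φ (S target) →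
                 sum (φ ∘ after) < sum (φ ∘ S)
    decreasing φ local = +-cancelʳ-< _ _ _ (begin-strict
      sum (φ ∘ after) + (φ rest + φ poured)             <⟨ +-monoʳ-< (sum (φ ∘ after)) local ⟩
      sum (φ ∘ after) + (φ (S source) + φ (S target))   ≡⟨ sum-after φ ⟩
      sum (φ ∘ S) + (φ rest + φ poured)                  ∎)
      where open ≤-Reasoning

    bounded-after : (∀ b → length (S b) ≤ h) → ∀ b → length (after b) ≤ h
    bounded-after bounded b with b ≟ source | b ≟ target
    ... | yes refl | _ = begin
      length (after source)                  ≡⟨ cong length after-source ⟩
      length rest                            ≤⟨ length-++-≤ˡ rest ⟩
      length (rest ++ replicate amount colour) ≡⟨ cong length source-split ⟨
      length (S source)                      ≤⟨ bounded source ⟩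
      h                                      ∎
      where open ≤-Reasoning
    ... | no _ | yes refl = ≤-trans (≤-reflexive (trans (cong length after-target) length-poured)) fits
    ... | no b≢s | no b≢t = ≤-trans (≤-reflexive (cong length (after-other b b≢s b≢t))) (bounded b)

  DescendingMove : ∀ {N} → Config N m → Set
  DescendingMove S = Σ (Move S) λ μ → potential (Move.after μ) < potential S

  module _ {N} {S : Config N m} {b₁ b₂ : Fin N} (b₁≢b₂ : b₁ ≢ b₂) where

    peel : (t : TopBlock (S b₁)) → TopBlock.below t ≢ [] →
           S b₂ ≡ [] ⊎ TopIs (S b₂) (TopBlock.colour t) →
           length (S b₂) + suc (TopBlock.height t) ≤ h → DescendingMove S
    peel t@(block below c k split ¬top) below≢[] top fit =
      μ , Move.decreasing μ weight (weights-drop-by-breaks (S b₁) (S b₂) below (Move.poured μ) fewer)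
      where
      μ : Move S
      μ = record { source = b₁ ; target = b₂ ; colour = c ; amount = suc k ; rest = below
                 ; source≢target = b₁≢b₂ ; amount-pos = s≤s z≤n ; source-split = split
                 ; target-top = top ; fits = fit ; maximal = inj₁ ¬top }
      fewer : breaks below + breaks (S b₂ ++ replicate (suc k) c) < breaks (S b₁) + breaks (S b₂)
      fewer = subst₂ (λ x y → breaks below + x < y + breaks (S b₂))
                     (sym (breaks-stack (S b₂) (suc k) c top)) (sym (breaks-block t below≢[])) ≤-refl

    pourAll : (t : TopBlock (S b₁)) → TopBlock.below t ≡ [] → Partial (S b₁) → Partial (S b₂) →
              TopIs (S b₂) (TopBlock.colour t) → length (S b₂) + suc (TopBlock.height t) ≤ h →
              DescendingMove S
    pourAll (block .[] c k split _) refl partial₁ partial₂ top fit =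
      μ , Move.decreasing μ weight (weights-drop-by-partials (S b₁) (S b₂) [] poured same fewer)
      where
      μ : Move S
      μ = record { source = b₁ ; target = b₂ ; colour = c ; amount = suc k ; rest = []
                 ; source≢target = b₁≢b₂ ; amount-pos = s≤s z≤n ; source-split = split
                 ; target-top = inj₂ top ; fits = fit ; maximal = inj₁ ¬TopIs-[] }
      poured = S b₂ ++ replicate (suc k) c
      same : breaks {m} [] + breaks poured ≡ breaks (S b₁) + breaks (S b₂)
      same = cong₂ _+_ (sym (trans (cong breaks split) (breaks-replicate (suc k) c)))
                       (breaks-stack (S b₂) (suc k) c (inj₂ top))
      fewer : 𝟙 (partial? []) + 𝟙 (partial? poured) < 𝟙 (partial? (S b₁)) + 𝟙 (partial? (S b₂))
      fewer rewrite 𝟙-no (partial? []) (λ { (() , _) }) | 𝟙-yes (partial? (S b₁)) partial₁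
                  | 𝟙-yes (partial? (S b₂)) partial₂ = s≤s (𝟙≤1 (partial? poured))

    fill : (t : TopBlock (S b₁)) → Partial (S b₁) → Partial (S b₂) → TopIs (S b₂) (TopBlock.colour t) →
           ∀ o r → TopBlock.height t ≡ o + suc r → length (S b₂) + suc r ≡ h → DescendingMove S
    fill (block below c .(o + suc r) split _) partial₁ partial₂ top o r refl full =
      μ , Move.decreasing μ weight (weights-drop-by-partials (S b₁) (S b₂) rest poured same fewer)
      where
      rest = below ++ replicate (suc o) c
      μ : Move S
      μ = record { source = b₁ ; target = b₂ ; colour = c ; amount = suc r ; rest = rest
                 ; source≢target = b₁≢b₂ ; amount-pos = s≤s z≤n
                 ; source-split = trans split (trans (cong (below ++_) (replicate-+ (suc o) (suc r) c))
                                                     (sym (++-assoc below _ _)))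
                 ; target-top = inj₂ top ; fits = ≤-reflexive full ; maximal = inj₂ full }
      poured = S b₂ ++ replicate (suc r) c
      same : breaks rest + breaks poured ≡ breaks (S b₁) + breaks (S b₂)
      same = cong₂ _+_ (trans (breaks-++-replicate below o c)
                              (sym (trans (cong breaks split) (breaks-++-replicate below (o + suc r) c))))
                       (breaks-stack (S b₂) (suc r) c (inj₂ top))
      ¬partial : ¬ Partial poured
      ¬partial (_ , short) = <-irrefl (trans (Move.length-poured μ) full) short
      fewer : 𝟙 (partial? rest) + 𝟙 (partial? poured) < 𝟙 (partial? (S b₁)) + 𝟙 (partial? (S b₂))
      fewer rewrite 𝟙-no (partial? poured) ¬partial | 𝟙-yes (partial? (S b₁)) partial₁
                  | 𝟙-yes (partial? (S b₂)) partial₂ =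
        s≤s (≤-trans (≤-reflexive (+-identityʳ _)) (𝟙≤1 (partial? rest)))

    merge : Partial (S b₁) → Partial (S b₂) → last (S b₁) ≡ last (S b₂) → DescendingMove S
    merge partial₁@(nonempty , _) partial₂@(_ , short) same-top = by-block (topBlockOf (S b₁) nonempty)
      where
      by-block : TopBlock (S b₁) → DescendingMove S
      by-block t@(block below c k split _)
        with top ← last⇒TopIs (S b₂) (trans (sym same-top) (last-block t))
        with r , room ← m≤n⇒∃[o]m+o≡n short
        with suc k ≤? suc r
      ... | yes k≤r = pour below refl
        where
        fit : length (S b₂) + suc k ≤ h
        fit = ≤-trans (+-monoʳ-≤ (length (S b₂)) k≤r) (≤-reflexive (trans (+-suc _ r) room))
        pour : (xs : List Colour) → below ≡ xs → DescendingMove S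
        pour []      below≡[] = pourAll t below≡[] partial₁ partial₂ top fit
        pour (_ ∷ _) refl     = peel t (λ ()) (inj₂ top) fit
      ... | no k≰r with o , r+o≡k ← m≤n⇒∃[o]m+o≡n (≤-pred (≰⇒> k≰r)) =
        fill t partial₁ partial₂ top o r (trans (sym r+o≡k) (+-comm (suc r) o)) (trans (+-suc _ r) room)

  -- The invariant and the double count

  colourTotal : ∀ {N} → Config N m → Colour → ℕ
  colourTotal {N} S c = ∑[ b < N ] count c (S b)

  top-occurs : ∀ {N} (S : Config N m) b {c} → last (S b) ≡ just c → 1 ≤ colourTotal S c
  top-occurs S b {c} top = ≤-trans (TopIs⇒count (last⇒TopIs (S b) top)) (≤-sum (λ b → count c (S b)) b)

  record Invariant (n k : ℕ) (S : Config (n + k) m) : Set where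
    field
      bounded         : ∀ b → length (S b) ≤ h
      colour-multiple : ∀ c → h ∣ colourTotal S c
      units           : ∑[ b < n + k ] length (S b) ≡ n * h
      spare           : (h ∸ 1) * n ≤ k * h

  invariant-after : ∀ {n k} {S : Config (n + k) m} (μ : Move S) → Invariant n k S → Invariant n k (Move.after μ)
  invariant-after μ I = record
    { bounded         = Move.bounded-after μ bounded
    ; colour-multiple = λ c → subst (h ∣_) (sym (Move.conserved μ (count c) (count-++ c))) (colour-multiple c)
    ; units           = trans (Move.conserved μ length (λ xs ys → length-++ xs)) units
    ; spare           = spare
    }
    where open Invariant I

  PartialTop : List Colour → Colour → Set
  PartialTop l c = Partial l × last l ≡ just c

  partialTop? : ∀ l c → Dec (PartialTop l c)
  partialTop? l c = partial? l ×-dec Maybe.≡-dec _≟_ (last l) (just c)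

  PartialPair : ∀ {N} → Config N m → Set
  PartialPair S =
    ∃₂ λ b₁ b₂ → b₁ ≢ b₂ × Partial (S b₁) × Partial (S b₂) × last (S b₁) ≡ last (S b₂)

  partialPair? : ∀ {N} (S : Config N m) → Dec (PartialPair S)
  partialPair? S = any? λ b₁ → any? λ b₂ →
    ¬? (b₁ ≟ b₂) ×-dec partial? (S b₁) ×-dec partial? (S b₂) ×-dec
    Maybe.≡-dec _≟_ (last (S b₁)) (last (S b₂))

  ∑-partialTop : ∀ l → ∑[ c < m ] 𝟙 (partialTop? l c) ≡ 𝟙 (partial? l)
  ∑-partialTop l = by-cases (partial? l)
    where
    by-cases : Dec (Partial l) → ∑[ c < m ] 𝟙 (partialTop? l c) ≡ 𝟙 (partial? l)
    by-cases (no ¬partial) =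
      trans (sum-zero _ (λ c → 𝟙-no (partialTop? l c) (¬partial ∘ proj₁))) (sym (𝟙-no (partial? l) ¬partial))
    by-cases (yes partial@(nonempty , _)) =
      trans (sum-cong-≗ pointwise) (trans (sum-𝟙-≟ colour) (sym (𝟙-yes (partial? l) partial)))
      where
      t : TopBlock l
      t = topBlockOf l nonempty
      open TopBlock t using (colour)
      top : last l ≡ just colour
      top = last-block t
      pointwise : ∀ c → 𝟙 (partialTop? l c) ≡ 𝟙 (c ≟ colour)
      pointwise c with c ≟ colour
      ... | yes refl = 𝟙-yes (partialTop? l c) (partial , top)
      ... | no c≢colour =
        𝟙-no (partialTop? l c) (λ (_ , top′) → c≢colour (Maybe.just-injective (trans (sym top′) top)))

  bin-bound : ∀ l → 1 ≤ length l → length l ≤ h → h + 𝟙 (partial? l) ≤ length l + 𝟙 (partial? l) * h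
  bin-bound l nonempty bounded with partial? l
  ... | yes _ =
    subst (_≤ length l + (h + 0)) (trans (cong suc (+-identityʳ h)) (+-comm 1 h)) (+-monoˡ-≤ (h + 0) nonempty)
  ... | no ¬partial = +-monoˡ-≤ 0 (≮⇒≥ (λ short → ¬partial (nonempty , short)))

  bin-bound-strict : ∀ l → Partial l → 2 ≤ length l → h + 𝟙 (partial? l) < length l + 𝟙 (partial? l) * h
  bin-bound-strict l partial long rewrite 𝟙-yes (partial? l) partial =
    subst (_≤ length l + (h + 0)) (cong suc (trans (cong suc (+-identityʳ h)) (+-comm 1 h))) (+-monoˡ-≤ (h + 0) long)

  colour-bound : ∀ {n k} {S : Config (n + k) m} → Invariant n k S → (w : Colour → ℕ) →
                 (∀ c → w c ≤ 1) → (∀ c → 1 ≤ w c → 1 ≤ colourTotal S c) → sum w * h ≤ n * h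
  colour-bound {n} {k} {S} I w w≤1 occupied = begin
    sum w * h                                ≡⟨ *-distribʳ-sum h w ⟩
    ∑[ c < m ] (w c * h)                     ≤⟨ sum-mono-≤ (λ c → bound (w c) (w≤1 c) (occupied c)) ⟩
    ∑[ c < m ] colourTotal S c               ≡⟨ ∑-comm (λ c b → count c (S b)) ⟩
    ∑[ b < n + k ] ∑[ c < m ] count c (S b)  ≡⟨ sum-cong-≗ (∑-count ∘ S) ⟩
    ∑[ b < n + k ] length (S b)              ≡⟨ Invariant.units I ⟩
    n * h                                    ∎
    where
    open ≤-Reasoning
    bound : ∀ {c} x → x ≤ 1 → (1 ≤ x → 1 ≤ colourTotal S c) → x * h ≤ colourTotal S c
    bound zero       _ _        = z≤n
    bound {c} (suc zero) _ occupied′ =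
      subst (_≤ colourTotal S c) (sym (+-identityʳ h))
            (∣⇒≤ {{>-nonZero (occupied′ (s≤s z≤n))}} (Invariant.colour-multiple I c))
    bound (suc (suc _)) (s≤s ()) _

  module _ {n k} {S : Config (n + k) m} (I : Invariant n k S)
           (no-empty : ∀ b → 1 ≤ length (S b)) (no-pair : ¬ PartialPair S) where

    private
      partials : ℕ
      partials = ∑[ b < n + k ] 𝟙 (partial? (S b))

      topCount : Colour → ℕ
      topCount c = ∑[ b < n + k ] 𝟙 (partialTop? (S b) c)

      ∑-topCount : sum topCount ≡ partials
      ∑-topCount = trans (∑-comm (λ c b → 𝟙 (partialTop? (S b) c))) (sum-cong-≗ (∑-partialTop ∘ S))

      topCount≤1 : ∀ c → topCount c ≤ 1
      topCount≤1 c = sum-≤1 _ (λ b → 𝟙≤1 (partialTop? (S b) c)) unique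
        where
        unique : ∀ b₁ b₂ → 1 ≤ 𝟙 (partialTop? (S b₁) c) → 1 ≤ 𝟙 (partialTop? (S b₂) c) → b₁ ≡ b₂
        unique b₁ b₂ top₁ top₂ with b₁ ≟ b₂
        ... | yes b₁≡b₂ = b₁≡b₂
        ... | no b₁≢b₂ with (partial₁ , last₁) ← 𝟙-witness (partialTop? (S b₁) c) top₁
                         | (partial₂ , last₂) ← 𝟙-witness (partialTop? (S b₂) c) top₂ =
          ⊥-elim (no-pair (b₁ , b₂ , b₁≢b₂ , partial₁ , partial₂ , trans last₁ (sym last₂)))

      topCount-occurs : ∀ c → 1 ≤ topCount c → 1 ≤ colourTotal S c
      topCount-occurs c topped with b , PT ← sum-positive _ topped =
        top-occurs S b (proj₂ (𝟙-witness (partialTop? (S b) c) PT))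

      open Invariant I

      ∑-lower : ∑[ b < n + k ] (h + 𝟙 (partial? (S b))) ≡ (n + k) * h + partials
      ∑-lower = trans (∑-distrib-+ {n + k} (λ _ → h) _) (cong (_+ partials) (sum-const (n + k) h))

      ∑-upper : ∑[ b < n + k ] (length (S b) + 𝟙 (partial? (S b)) * h) ≡ n * h + partials * h
      ∑-upper = trans (∑-distrib-+ (length ∘ S) _) (cong₂ _+_ units (sym (*-distribʳ-sum {n + k} h _)))

      bin-bound′ : ∀ b → h + 𝟙 (partial? (S b)) ≤ length (S b) + 𝟙 (partial? (S b)) * h
      bin-bound′ b = bin-bound (S b) (no-empty b) (bounded b)

    long-partial-impossible : ∀ b → Partial (S b) → ¬ 2 ≤ length (S b)
    long-partial-impossible b partial long = spare-vs-capacity-< h spare tops capacity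
      where
      capacity : (n + k) * h + partials < n * h + partials * h
      capacity = subst₂ _<_ ∑-lower ∑-upper (sum-mono-< bin-bound′ b (bin-bound-strict (S b) partial long))
      tops : partials * h ≤ n * h
      tops = subst (λ x → x * h ≤ n * h) ∑-topCount (colour-bound I topCount topCount≤1 topCount-occurs)

    colour-on-partial-top : 2 ≤ h → ∀ c → 1 ≤ colourTotal S c → ∃ λ b → PartialTop (S b) c
    colour-on-partial-top 2≤h c occupied with any? (λ b → partialTop? (S b) c)
    ... | yes found = found
    ... | no none = ⊥-elim (spare-vs-capacity-≤ h 2≤h spare tops capacity)
      where
      capacity : (n + k) * h + partials ≤ n * h + partials * h
      capacity = subst₂ _≤_ ∑-lower ∑-upper (sum-mono-≤ bin-bound′)
      untopped : topCount c ≡ 0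
      untopped = sum-zero _ (λ b → 𝟙-no (partialTop? (S b) c) (λ PT → none (b , PT)))
      w : Colour → ℕ
      w c′ = topCount c′ + 𝟙 (c′ ≟ c)
      w≤1 : ∀ c′ → w c′ ≤ 1
      w≤1 c′ with c′ ≟ c
      ... | yes refl = ≤-reflexive (cong (_+ 1) untopped)
      ... | no _     = ≤-trans (≤-reflexive (+-identityʳ _)) (topCount≤1 c′)
      w-occurs : ∀ c′ → 1 ≤ w c′ → 1 ≤ colourTotal S c′
      w-occurs c′ 1≤w with c′ ≟ c
      ... | yes refl = occupied
      ... | no _     = topCount-occurs c′ (≤-trans 1≤w (≤-reflexive (+-identityʳ _)))
      ∑w : sum w ≡ suc partials
      ∑w = trans (∑-distrib-+ topCount _) (trans (cong₂ _+_ ∑-topCount (sum-𝟙-≟ c)) (+-comm partials 1))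
      tops : suc partials * h ≤ n * h
      tops = subst (λ x → x * h ≤ n * h) ∑w (colour-bound I w w≤1 w-occurs)

  module _ {n k} {S : Config (n + k) m} (I : Invariant n k S)
           (unbroken : ∀ b → breaks (S b) ≡ 0) (no-pair : ¬ PartialPair S) where
    open Invariant I

    private
      length-mono : ∀ {l : List Colour} {a c} → l ≡ replicate (suc a) c → length l ≡ suc a
      length-mono {a = a} refl = length-replicate (suc a)

      last-mono : ∀ {l : List Colour} {a c} → l ≡ replicate (suc a) c → last l ≡ just c
      last-mono {a = a} {c} refl = TopIs⇒last (TopIs-++-replicate [] a c)

      full-or-partial-mono : ∀ i {a c} → S i ≡ replicate (suc a) c → suc a ≡ h ⊎ Partial (S i)
      full-or-partial-mono i mono
        with full-or-partial (S i) (≤-trans (s≤s z≤n) (≤-reflexive (sym (length-mono mono)))) (bounded i)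
      ... | inj₁ full    = inj₁ (trans (sym (length-mono mono)) full)
      ... | inj₂ partial = inj₂ partial

      h∣count-elsewhere : ∀ b {a c} → S b ≡ replicate (suc a) c → Partial (S b) →
                          ∀ i → i ≢ b → h ∣ count c (S i)
      h∣count-elsewhere b {c = c} mono partial i i≢b with monochrome (S i) (unbroken i)
      ... | inj₁ empty = subst (λ l → h ∣ count c l) (sym empty) (h ∣0)
      ... | inj₂ (a′ , c′ , mono′) with c ≟ c′
      ...   | no c≢c′ =
        subst (h ∣_) (sym (trans (cong (count c) mono′) (count-replicate-≢ (suc a′) c≢c′))) (h ∣0)
      ...   | yes refl with full-or-partial-mono i mono′
      ...     | inj₁ full =
        subst (h ∣_) (sym (trans (cong (count c) mono′) (trans (count-replicate-≡ c (suc a′)) full))) ∣-refl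
      ...     | inj₂ partial′ =
        ⊥-elim (no-pair (i , b , i≢b , partial′ , partial , trans (last-mono mono′) (sym (last-mono mono))))

      monochrome-full : ∀ b {a c} → S b ≡ replicate (suc a) c → suc a ≡ h
      monochrome-full b {a} {c} mono with full-or-partial-mono b mono
      ... | inj₁ full = full
      ... | inj₂ partial@(_ , short) = ⊥-elim (<⇒≱ (subst (_< h) (length-mono mono) short) (∣⇒≤ h∣a))
        where
        others : Config (n + k) m
        others = updateAt S b (const [])
        h∣others : ∀ i → h ∣ count c (others i)
        h∣others i with i ≟ b
        ... | yes refl = subst (λ l → h ∣ count c l) (sym (updateAt-updates b S)) (h ∣0)
        ... | no i≢b   = subst (λ l → h ∣ count c l) (sym (updateAt-minimal i b S i≢b))
                                (h∣count-elsewhere b mono partial i i≢b)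
        split : colourTotal S c ≡ sum (count c ∘ others) + suc a
        split = begin
          colourTotal S c                          ≡⟨ +-identityʳ _ ⟨
          colourTotal S c + count c []             ≡⟨ sum-updateAt (count c) S b [] ⟨
          sum (count c ∘ others) + count c (S b)
            ≡⟨ cong (sum (count c ∘ others) +_) (trans (cong (count c) mono) (count-replicate-≡ c (suc a))) ⟩
          sum (count c ∘ others) + suc a           ∎
          where open ≡-Reasoning
        h∣a : h ∣ suc a
        h∣a = ∣m+n∣m⇒∣n (subst (h ∣_) split (colour-multiple c)) (∣-sum _ h∣others)

    sorted : Sorted h S
    sorted b with monochrome (S b) (unbroken b)
    ... | inj₁ empty          = inj₁ empty
    ... | inj₂ (a , c , mono) = inj₂ (c , trans mono (cong (λ j → replicate j c) (monochrome-full b mono)))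

  module _ {n k} {S : Config (n + k) m} (I : Invariant n k S) (no-pair : ¬ PartialPair S) where
    open Invariant I

    repair : ∀ b → 1 ≤ breaks (S b) → DescendingMove S
    repair b broken = by-cases (any? (λ e → length (S e) ℕ.≟ 0))
      where
      t : TopBlock (S b)
      t = proj₁ (brokenBlock (S b) broken)
      open TopBlock t
      below≢[] : below ≢ []
      below≢[] = proj₂ (brokenBlock (S b) broken)
      block<bin : suc height < length (S b)
      block<bin = subst (suc height <_) (sym (length-block t))
                        (m<n+m (suc height) (n≢0⇒n>0 (below≢[] ∘ length≡0⇒[])))
      by-cases : Dec (∃ λ e → length (S e) ≡ 0) → DescendingMove S
      by-cases (yes (e , empty)) = peel b≢e t below≢[] (inj₁ (length≡0⇒[] empty)) fit
        where
        b≢e : b ≢ e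
        b≢e refl = n≮0 (subst (suc height <_) empty block<bin)
        fit : length (S e) + suc height ≤ h
        fit rewrite empty = ≤-trans (<⇒≤ block<bin) (bounded b)
      by-cases (no none) = peel b≢b₂ t below≢[] (inj₂ (last⇒TopIs (S b₂) top₂)) fit
        where
        no-empty : ∀ b′ → 1 ≤ length (S b′)
        no-empty b′ = n≢0⇒n>0 (λ empty → none (b′ , empty))
        full : length (S b) ≡ h
        full with full-or-partial (S b) (no-empty b) (bounded b)
        ... | inj₁ full    = full
        ... | inj₂ partial =
          ⊥-elim (long-partial-impossible I no-empty no-pair b partial (≤-trans (s≤s (s≤s z≤n)) block<bin))
        found : ∃ λ b₂ → PartialTop (S b₂) colour
        found = colour-on-partial-top I no-empty no-pair (subst (2 ≤_) full (≤-trans (s≤s (s≤s z≤n)) block<bin))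
                                      colour (top-occurs S b (last-block t))
        b₂ : Fin (n + k)
        b₂ = proj₁ found
        partial₂ : Partial (S b₂)
        partial₂ = proj₁ (proj₂ found)
        top₂ : last (S b₂) ≡ just colour
        top₂ = proj₂ (proj₂ found)
        b≢b₂ : b ≢ b₂
        b≢b₂ b≡b₂ = <-irrefl full (proj₂ (subst (Partial ∘ S) (sym b≡b₂) partial₂))
        fit : length (S b₂) + suc height ≤ h
        fit = begin
          length (S b₂) + suc height
            ≤⟨ +-monoˡ-≤ (suc height) (≮⇒≥ (long-partial-impossible I no-empty no-pair b₂ partial₂)) ⟩
          1 + suc height            ≤⟨ block<bin ⟩
          length (S b)              ≡⟨ full ⟩
          h                         ∎
          where open ≤-Reasoning

  -- Progress, termination and instances

  progress : ∀ {n k} {S : Config (n + k) m} → Invariant n k S → Sorted h S ⊎ DescendingMove S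
  progress {S = S} I with partialPair? S
  ... | yes (_ , _ , b₁≢b₂ , partial₁ , partial₂ , same-top) = inj₂ (merge b₁≢b₂ partial₁ partial₂ same-top)
  ... | no no-pair with any? (λ b → 1 ≤? breaks (S b))
  ...   | yes (b , broken) = inj₂ (repair I no-pair b broken)
  ...   | no unbroken      = inj₁ (sorted I (λ b → n<1⇒n≡0 (≰⇒> (unbroken ∘ (b ,_)))) no-pair)

  solve-within : ∀ {n k} fuel (S : Config (n + k) m) → potential S ≤ fuel → Invariant n k S → Solvable h S
  solve-within fuel S bound I with progress I
  ... | inj₁ done = S , ε , done
  ... | inj₂ (μ , drop) with fuel
  ...   | zero      = ⊥-elim (n≮0 (<-≤-trans drop bound))
  ...   | suc fuel′
    with S′ , moves , done ← solve-within fuel′ (Move.after μ) (≤-pred (≤-trans drop bound)) (invariant-after μ I) =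
    S′ , Move.waterMove μ ◅ moves , done

  module _ {n k} (S : Config (n + k) m) (0<h : 0 < h) (instance′ : IsInstance h n k m S) where
    private
      full? : ∀ b → Dec (length (S b) ≡ h)
      empty? : ∀ b → Dec (length (S b) ≡ 0)
      full? b = length (S b) ℕ.≟ h
      empty? b = length (S b) ℕ.≟ 0

      kind≤1 : ∀ b → 𝟙 (full? b) + 𝟙 (empty? b) ≤ 1
      kind≤1 b with full? b | empty? b
      ... | yes full | yes empty = ⊥-elim (<-irrefl (trans (sym empty) full) 0<h)
      ... | yes _    | no _      = s≤s z≤n
      ... | no _     | yes _     = s≤s z≤n
      ... | no _     | no _      = z≤n

      ∑kind : ∑[ b < n + k ] (𝟙 (full? b) + 𝟙 (empty? b)) ≡ ∑[ b < n + k ] 1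
      ∑kind = begin
        ∑[ b < n + k ] (𝟙 (full? b) + 𝟙 (empty? b)) ≡⟨ ∑-distrib-+ (𝟙 ∘ full?) (𝟙 ∘ empty?) ⟩
        sum (𝟙 ∘ full?) + sum (𝟙 ∘ empty?)          ≡⟨ cong₂ _+_ (countBins≡∑ full?) (countBins≡∑ empty?) ⟨
        countBins full? + countBins empty?          ≡⟨ cong₂ _+_ (proj₁ instance′) (proj₁ (proj₂ instance′)) ⟩
        n + k                                       ≡⟨ trans (sum-const (n + k) 1) (*-identityʳ (n + k)) ⟨
        ∑[ b < n + k ] 1                            ∎
        where open ≡-Reasoning

    full-or-empty : ∀ b → length (S b) ≡ h ⊎ length (S b) ≡ 0
    full-or-empty b with full? b | empty? b | sum-≡-pointwise kind≤1 ∑kind b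
    ... | yes full | _         | _ = inj₁ full
    ... | no _     | yes empty | _ = inj₂ empty
    ... | no _     | no _      | ()

    instance-invariant : (h ∸ 1) * n ≤ k * h → Invariant n k S
    instance-invariant spare = record
      { bounded         = bounded
      ; colour-multiple = colour-multiple
      ; units           = units
      ; spare           = spare
      }
      where
      bounded : ∀ b → length (S b) ≤ h
      bounded b with full-or-empty b
      ... | inj₁ full  = ≤-reflexive full
      ... | inj₂ empty = subst (_≤ h) (sym empty) z≤n

      units : ∑[ b < n + k ] length (S b) ≡ n * h
      units = begin
        ∑[ b < n + k ] length (S b)        ≡⟨ sum-cong-≗ length≡ ⟩
        ∑[ b < n + k ] (𝟙 (full? b) * h)   ≡⟨ *-distribʳ-sum h (𝟙 ∘ full?) ⟨
        sum (𝟙 ∘ full?) * h                ≡⟨ cong (_* h) (trans (sym (countBins≡∑ full?)) (proj₁ instance′)) ⟩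
        n * h                              ∎
        where
        open ≡-Reasoning
        length≡ : ∀ b → length (S b) ≡ 𝟙 (full? b) * h
        length≡ b with full? b | full-or-empty b
        ... | yes full | _          = trans full (sym (+-identityʳ h))
        ... | no ¬full | inj₁ full  = ⊥-elim (¬full full)
        ... | no _     | inj₂ empty = empty

      colour-multiple : ∀ c → h ∣ colourTotal S c
      colour-multiple c with j , _ , occurrences≡ ← proj₂ (proj₂ instance′) c =
        divides j (trans (sym (occurrences≡∑ S c)) (trans occurrences≡ (*-comm h j)))

theorem14 : (n h : ℕ) → 1 ≤ n → .{{_ : NonZero h}} → (m : ℕ)
    → (S : Config (n + ⌈ (h ∸ 1) * n / h ⌉) m)
    → IsInstance h n ⌈ (h ∸ 1) * n / h ⌉ m S
    → Solvable h S
theorem14 n h _ m S instance′ = solve-within (potential S) S ≤-refl invariant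
  where
  open Sorting {m} h
  invariant : Invariant n ⌈ (h ∸ 1) * n / h ⌉ S
  invariant = instance-invariant S (>-nonZero⁻¹ h) instance′ (m≤⌈m/n⌉*n ((h ∸ 1) * n) h)
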